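{- The order of $K$-promotion on $\mathrm{Inc}_k(N-r,1^r)$ is equal to $N-k-1$; that is, $N-k-1$ is the smallest positive integer $\ell$ such that $\partial^\ell(T)=T$ for all $T\in\mathrm{Inc}_k(N-r,1^r)$.
   Context: For a partition $\lambda$ of $N$, an increasing $\lambda$-tableau is a filling of the Young diagram of $\lambda$ with positive integers, strictly increasing along rows and down columns, such that if $N-k$ is the largest entry then every integer $1,\dots,N-k$ appears. $\mathrm{Inc}_k(\lambda)$ is the set of such tableaux with maximum entry $N-k$. The hook shape $(N-r,1^r)$ has first row of length $N-r$ and first column of length $r+1$. $K$-promotion $\partial$ on $\mathrm{Inc}_k(N-r,1^r)$: replace the entry $1$ (in box $(1,1)$) by a dot, then repeatedly move dots: a dot with right neighbour $a$ and lower neighbour $b$ becomes: if $a<b$, $a$ moves into the dot's box and the dot moves right; if $b<a$, $b$ moves into the dot's box and the dot moves down; if $a=b$, $a$ moves into the dot's box and dots occupy both the box to the right and the box below (a dot with only one neighbour exchanges with it). Continue until every dot lies in the last box of the row or the last box of the column; then replace each dot by $N-k$ and decrease every other entry by $1$. -}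

module Defs where

open import Data.Nat using (ℕ; zero; suc; _+_; _∸_; _≤_; _<_; _≟_; compare; less; equal; greater)
open import Data.Nat.Properties using (<-cmp)
open import Data.List using (List; []; _∷_; _++_)
open import Data.List.Membership.Propositional using (_∈_)
open import Data.List.Relation.Unary.All using (All)
open import Data.List.Relation.Unary.Linked using (Linked)
open import Data.Vec using (Vec; []; _∷_; toList; map)
open import Data.Maybe using (Maybe; just; nothing)
open import Data.Product using (_×_)
open import Relation.Nullary using (¬_)
open import Relation.Binary using (tri<; tri≈; tri>)
open import Relation.Binary.PropositionalEquality using (_≡_)

-- Fillings of the hook shape (1 + a , 1^b):
--   corner = entry of box (1,1),
--   arm    = entries of boxes (1,2) … (1,a+1)   (rest of the first row),
--   leg    = entries of boxes (2,1) … (b+1,1)   (rest of the first column).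
-- The hook (N-r, 1^r) corresponds to a = N ∸ r ∸ 1, b = r.

record HookFilling (a b : ℕ) : Set where
  constructor hook
  field
    corner : ℕ
    arm    : Vec ℕ a
    leg    : Vec ℕ b
open HookFilling public

entries : ∀ {a b} → HookFilling a b → List ℕ
entries (hook c r l) = c ∷ (toList r ++ toList l)

IsIncreasing : ∀ {a b} → ℕ → HookFilling a b → Set
IsIncreasing M t =
  Linked _<_ (corner t ∷ toList (arm t)) ×
  Linked _<_ (corner t ∷ toList (leg t)) ×
  All (λ x → 1 ≤ x) (entries t) ×
  All (λ x → x ≤ M) (entries t) ×
  (∀ v → 1 ≤ v → v ≤ M → v ∈ entries t)

Inc : (N r k : ℕ) → HookFilling (N ∸ r ∸ 1) r → Set
Inc N r k t = IsIncreasing (N ∸ k) t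

-- K-promotion.  A cell holds either an entry (just v) or a dot (nothing).

Cell : Set
Cell = Maybe ℕ

record DottedHook (a b : ℕ) : Set where
  constructor dhook
  field
    dcorner : Cell
    darm    : Vec Cell a
    dleg    : Vec Cell b

-- A dot sitting in front of the entries xs, with only one neighbour at each
-- step (true for the arm and leg of a hook), exchanges with its neighbour
-- until it reaches the last box.
slideDot : ∀ {n} → Vec ℕ n → Vec Cell (suc n)
slideDot []       = nothing ∷ []
slideDot (x ∷ xs) = just x ∷ slideDot xs

slide : ∀ {a b} → HookFilling a b → DottedHook a b
slide (hook _ []       [])       = dhook nothing [] []
slide (hook _ (x ∷ xs) [])       = dhook (just x) (slideDot xs) []
slide (hook _ []       (y ∷ ys)) = dhook (just y) [] (slideDot ys)
slide (hook _ (x ∷ xs) (y ∷ ys)) with <-cmp x y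
... | tri< _ _ _ = dhook (just x) (slideDot xs) (map just (y ∷ ys))
... | tri> _ _ _ = dhook (just y) (map just (x ∷ xs)) (slideDot ys)
... | tri≈ _ _ _ = dhook (just x) (slideDot xs) (slideDot ys)

finalize : ℕ → Cell → ℕ
finalize M nothing  = M
finalize M (just v) = v ∸ 1

promotion : ∀ {a b} → ℕ → HookFilling a b → HookFilling a b
promotion M t with slide t
... | dhook c r l = hook (finalize M c) (map (finalize M) r) (map (finalize M) l)

iter : ∀ {A : Set} → ℕ → (A → A) → A → A
iter zero    f x = x
iter (suc n) f x = f (iter n f x)

FixesAll : (N r k ℓ : ℕ) → Set
FixesAll N r k ℓ =
  ∀ (T : HookFilling (N ∸ r ∸ 1) r) → Inc N r k T → iter ℓ (promotion (N ∸ k)) T ≡ T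

IsPromotionOrder : (N r k ℓ : ℕ) → Set
IsPromotionOrder N r k ℓ =
  1 ≤ ℓ × FixesAll N r k ℓ × (∀ m → 1 ≤ m → m < ℓ → ¬ FixesAll N r k m)

-- An increasing hook tableau with maximum entry M has corner 1, and its arm and leg are
-- increasing sequences in {2, …, M} whose union is {2, …, M}.  Promotion slides the dot along
-- the row(s) beginning with 2, and the effect is that each row, read as a set S, becomes
-- ρ⁻¹(S) for the cycle ρ = (2 3 … M).  Hence ∂ has period M − 1 = N − k − 1.  No smaller
-- period works: choose the tableau whose arm is 2, …, a + 1, or, when the arm is all of
-- {2, …, M}, whose leg is 2, …, k + 1; a proper interval of the cycle is moved by every
-- nontrivial power of ρ.
module Submission where

open import Defs
open import Data.Nat using (ℕ; zero; suc; _+_; _∸_; _≤_; _<_; z≤n; s≤s; z<s; _≤?_; _<?_)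
open import Data.Nat.Properties
open import Data.List as List using (List; []; _∷_; _++_; [_])
open import Data.List.Membership.Propositional using (_∈_)
open import Data.List.Membership.Propositional.Properties using (∈-map⁺; ∈-map⁻; ∈-++⁺ˡ; ∈-++⁺ʳ; ∈-++⁻)
open import Data.List.Relation.Unary.Any using (here; there)
open import Data.List.Relation.Unary.All as All using (All; []; _∷_)
import Data.List.Relation.Unary.All.Properties as All
open import Data.List.Relation.Unary.Linked as Linked using (Linked; []; [-]; _∷_)
open import Data.List.Relation.Unary.Linked.Properties using (Linked⇒All)
open import Data.Vec as Vec using (Vec; []; _∷_; toList)
open import Data.Vec.Properties using (toList-++; toList-injective; cast-is-id)
open import Data.Maybe using (just)
open import Data.Product using (_×_; _,_; proj₁; proj₂)
open import Data.Sum as Sum using (_⊎_; inj₁; inj₂)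
open import Data.Empty using (⊥-elim)
open import Function using (_∘_)
open import Function.Bundles using (_⇔_; mk⇔; Equivalence)
import Function.Properties.Equivalence as ⇔
open import Relation.Nullary using (¬_; yes; no)
open import Relation.Binary.PropositionalEquality using (_≡_; _≢_; refl; sym; trans; cong; cong₂; subst; subst₂; module ≡-Reasoning)

open Equivalence using (to; from)

linked-head< : ∀ {p xs} → Linked _<_ (p ∷ xs) → All (p <_) xs
linked-head< [-]         = []
linked-head< (p<x ∷ l) = Linked⇒All <-trans p<x l

linked-<-unique : ∀ {xs ys : List ℕ} → Linked _<_ xs → Linked _<_ ys →
  (∀ {v} → v ∈ xs → v ∈ ys) → (∀ {v} → v ∈ ys → v ∈ xs) → xs ≡ ys
linked-<-unique {[]}     {[]}     _ _ _ _ = refl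
linked-<-unique {[]}     {y ∷ _}  _ _ _ ys⊆xs with () ← ys⊆xs (here refl)
linked-<-unique {x ∷ _}  {[]}     _ _ xs⊆ys _ with () ← xs⊆ys (here refl)
linked-<-unique {x ∷ xs} {y ∷ ys} lx ly xs⊆ys ys⊆xs =
  cong₂ _∷_ x≡y (linked-<-unique (Linked.tail lx) (Linked.tail ly) tail⊆ tail⊇)
  where
  x≡y : x ≡ y
  x≡y with xs⊆ys (here refl) | ys⊆xs (here refl)
  ... | here x≡y | _        = x≡y
  ... | there x∈ | here y≡x = sym y≡x
  ... | there x∈ | there y∈ =
    ⊥-elim (<-asym (All.lookup (linked-head< ly) x∈) (All.lookup (linked-head< lx) y∈))
  tail⊆ : ∀ {v} → v ∈ xs → v ∈ ys
  tail⊆ v∈ with xs⊆ys (there v∈)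
  ... | here v≡y = ⊥-elim (<-irrefl (trans x≡y (sym v≡y)) (All.lookup (linked-head< lx) v∈))
  ... | there v∈ys = v∈ys
  tail⊇ : ∀ {v} → v ∈ ys → v ∈ xs
  tail⊇ v∈ with ys⊆xs (there v∈)
  ... | here v≡x = ⊥-elim (<-irrefl (trans (sym x≡y) (sym v≡x)) (All.lookup (linked-head< ly) v∈))
  ... | there v∈xs = v∈xs

iter-suc : ∀ {A : Set} (f : A → A) j x → iter j f (f x) ≡ iter (suc j) f x
iter-suc f zero    x = refl
iter-suc f (suc j) x = cong f (iter-suc f j x)

iter-+ : ∀ {A : Set} (f : A → A) i j x → iter (i + j) f x ≡ iter i f (iter j f x)
iter-+ f zero    j x = refl
iter-+ f (suc i) j x = cong f (iter-+ f i j x)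

rotate : ℕ → ℕ → ℕ
rotate M v with M ≤? v
... | yes _ = 2
... | no  _ = suc v

rotate-< : ∀ {M v} → v < M → rotate M v ≡ suc v
rotate-< {M} {v} v<M with M ≤? v
... | yes M≤v = ⊥-elim (<⇒≱ v<M M≤v)
... | no  _   = refl

rotate-max : ∀ M → rotate M M ≡ 2
rotate-max M with M ≤? M
... | yes _   = refl
... | no  M≰M = ⊥-elim (M≰M ≤-refl)

rotate-cases : ∀ {M v} → v ≤ M → (v < M × rotate M v ≡ suc v) ⊎ (v ≡ M × rotate M v ≡ 2)
rotate-cases v≤M with m≤n⇒m<n∨m≡n v≤M
... | inj₁ v<M  = inj₁ (v<M , rotate-< v<M)
... | inj₂ refl = inj₂ (refl , rotate-max _)

rotate-range : ∀ {M v} → 2 ≤ v → v ≤ M → 2 ≤ rotate M v × rotate M v ≤ M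
rotate-range 2≤v v≤M with rotate-cases v≤M
... | inj₁ (v<M , eq) rewrite eq = m≤n⇒m≤1+n 2≤v , v<M
... | inj₂ (refl , eq) rewrite eq = ≤-refl , 2≤v

iter-rotate-< : ∀ M j v → v + j ≤ M → iter j (rotate M) v ≡ v + j
iter-rotate-< M zero    v _       = sym (+-identityʳ v)
iter-rotate-< M (suc j) v v+j<M rewrite +-suc v j =
  trans (cong (rotate M) (iter-rotate-< M j v (<⇒≤ v+j<M))) (rotate-< v+j<M)

-- Starting from v, the orbit climbs to M, wraps to 2 and climbs back to v: M ∸ 1 steps.
rotate-period : ∀ {M v} → 2 ≤ v → v ≤ M → iter (M ∸ 1) (rotate M) v ≡ v
rotate-period {M} {v} 2≤v v≤M with m≤n⇒∃[o]m+o≡n 2≤v | m≤n⇒∃[o]m+o≡n v≤M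
... | p , refl | q , refl = begin
  iter (suc (p + q)) (rotate M) (2 + p)
    ≡⟨ cong (λ n → iter n (rotate M) (2 + p)) (+-suc p q) ⟨
  iter (p + suc q) (rotate M) (2 + p)
    ≡⟨ iter-+ (rotate M) p (suc q) (2 + p) ⟩
  iter p (rotate M) (rotate M (iter q (rotate M) (2 + p)))
    ≡⟨ cong (iter p (rotate M) ∘ rotate M) (iter-rotate-< M q (2 + p) ≤-refl) ⟩
  iter p (rotate M) (rotate M M)
    ≡⟨ cong (iter p (rotate M)) (rotate-max M) ⟩
  iter p (rotate M) 2
    ≡⟨ iter-rotate-< M p 2 (m≤m+n (2 + p) q) ⟩
  2 + p ∎
  where open ≡-Reasoning

rotate-moves-interval : ∀ {M c m} → 1 ≤ c → 2 + c ≤ M → 1 ≤ m → 2 + m ≤ M →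
  ¬ (∀ v → 2 ≤ v → v < 2 + c → iter m (rotate M) v < 2 + c)
rotate-moves-interval {M} {c} {m} 1≤c c+2≤M 1≤m m+2≤M closed =
  <-irrefl shifted (closed v (m≤m+n 2 (c ∸ m)) v<c+2)
  where
  m<c : m < c
  m<c = ≤-pred (≤-pred (subst (_< 2 + c) (iter-rotate-< M m 2 m+2≤M)
          (closed 2 ≤-refl (s≤s (s≤s 1≤c)))))
  v : ℕ
  v = 2 + (c ∸ m)
  v+m≡c+2 : v + m ≡ 2 + c
  v+m≡c+2 = cong (2 +_) (m∸n+n≡m (<⇒≤ m<c))
  v<c+2 : v < 2 + c
  v<c+2 = s≤s (s≤s (∸-monoʳ-< 1≤m (<⇒≤ m<c)))
  shifted : iter m (rotate M) v ≡ 2 + c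
  shifted = trans (iter-rotate-< M m v (subst (_≤ M) (sym v+m≡c+2) c+2≤M)) v+m≡c+2

record Row (M : ℕ) (xs : List ℕ) : Set where
  constructor row
  field
    increasing : Linked _<_ (1 ∷ xs)
    bounded    : All (_≤ M) xs

row-range : ∀ {M xs v} → Row M xs → v ∈ xs → 2 ≤ v × v ≤ M
row-range (row inc bnd) v∈ = All.lookup (linked-head< inc) v∈ , All.lookup bnd v∈

row-head≥2 : ∀ {M x xs} → Row M (x ∷ xs) → 2 ≤ x
row-head≥2 r = Linked.head (Row.increasing r)

row-head≡2 : ∀ {M x xs} → Row M (x ∷ xs) → 2 ∈ x ∷ xs → x ≡ 2
row-head≡2 _                 (here 2≡x) = sym 2≡x
row-head≡2 (row (1<x ∷ l) _) (there 2∈) = ⊥-elim (<⇒≱ (All.lookup (linked-head< l) 2∈) 1<x)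

record HookRows (M : ℕ) (xs ys : List ℕ) : Set where
  constructor hookRows
  field
    armRow : Row M xs
    legRow : Row M ys
    covers : ∀ v → 2 ≤ v → v ≤ M → v ∈ xs ⊎ v ∈ ys

hookRows-head≡2 : ∀ {M x y xs ys} → 2 ≤ M → HookRows M (x ∷ xs) (y ∷ ys) → x ≡ 2 ⊎ y ≡ 2
hookRows-head≡2 2≤M (hookRows armRow legRow covers) with covers 2 ≤-refl 2≤M
... | inj₁ 2∈ = inj₁ (row-head≡2 armRow 2∈)
... | inj₂ 2∈ = inj₂ (row-head≡2 legRow 2∈)

increasing⇒hookRows : ∀ {a b M} (T : HookFilling a b) → 1 ≤ M → IsIncreasing M T →
  corner T ≡ 1 × HookRows M (toList (arm T)) (toList (leg T))
increasing⇒hookRows {M = M} (hook c r l) 1≤M (armInc , legInc , pos , bnd , cov) with cov 1 ≤-refl 1≤M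
... | here refl =
  refl , hookRows (row armInc (All.++⁻ˡ _ (All.tail bnd))) (row legInc (All.++⁻ʳ _ (All.tail bnd))) covers
  where
  covers : ∀ v → 2 ≤ v → v ≤ M → v ∈ toList r ⊎ v ∈ toList l
  covers v 2≤v v≤M with cov v (<⇒≤ 2≤v) v≤M
  ... | here v≡1  = ⊥-elim (<-irrefl (sym v≡1) 2≤v)
  ... | there v∈ = ∈-++⁻ (toList r) v∈
... | there 1∈ with ∈-++⁻ (toList r) 1∈
...   | inj₁ 1∈r = ⊥-elim (<⇒≱ (All.lookup (linked-head< armInc) 1∈r) (All.head pos))
...   | inj₂ 1∈l = ⊥-elim (<⇒≱ (All.lookup (linked-head< legInc) 1∈l) (All.head pos))

hookRows⇒increasing : ∀ {a b M} (T : HookFilling a b) → 1 ≤ M → corner T ≡ 1 →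
  HookRows M (toList (arm T)) (toList (leg T)) → IsIncreasing M T
hookRows⇒increasing {M = M} (hook _ r l) 1≤M refl (hookRows (row armInc armBnd) (row legInc legBnd) cov) =
  armInc , legInc ,
  ≤-refl ∷ All.++⁺ (positive armInc) (positive legInc) ,
  1≤M ∷ All.++⁺ armBnd legBnd ,
  covers
  where
  positive : ∀ {xs} → Linked _<_ (1 ∷ xs) → All (1 ≤_) xs
  positive = All.map <⇒≤ ∘ linked-head<
  covers : ∀ v → 1 ≤ v → v ≤ M → v ∈ 1 ∷ toList r ++ toList l
  covers v 1≤v v≤M with m≤n⇒m<n∨m≡n 1≤v
  ... | inj₂ refl = here refl
  ... | inj₁ 1<v with cov v 1<v v≤M
  ...   | inj₁ v∈r = there (∈-++⁺ˡ v∈r)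
  ...   | inj₂ v∈l = there (∈-++⁺ʳ (toList r) v∈l)

-- After ∂, the entries of a row drop by one, and the row headed by 2, along which the
-- dot slides, ends with the new entry M.
promoteRow : ℕ → List ℕ → List ℕ
promoteRow M (2 ∷ xs) = List.map (_∸ 1) xs ++ [ M ]
promoteRow M xs       = List.map (_∸ 1) xs

linked-∸1 : ∀ {p xs} → Linked _<_ (suc p ∷ xs) → Linked _<_ (p ∷ List.map (_∸ 1) xs)
linked-∸1 [-]             = [-]
linked-∸1 (s≤s p<x ∷ l) = p<x ∷ linked-∸1 l

linked-∸1-++ : ∀ {M p xs} → All (_≤ M) (suc p ∷ xs) → Linked _<_ (suc p ∷ xs) →
  Linked _<_ (p ∷ List.map (_∸ 1) xs ++ [ M ])
linked-∸1-++ (p<M ∷ []) [-]           = p<M ∷ [-]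
linked-∸1-++ (_ ∷ bnd)  (s≤s p<x ∷ l) = p<x ∷ linked-∸1-++ bnd l

bounded-∸1 : ∀ {M xs} → All (_≤ M) xs → All (_≤ M) (List.map (_∸ 1) xs)
bounded-∸1 = All.map⁺ ∘ All.map (≤-trans (m∸n≤m _ 1))

∈-map-∸1 : ∀ {v xs} → All (1 ≤_) xs → v ∈ List.map (_∸ 1) xs ⇔ suc v ∈ xs
∈-map-∸1 {xs = xs} pos = mk⇔ suc∈ (∈-map⁺ (_∸ 1))
  where
  suc∈ : ∀ {v} → v ∈ List.map (_∸ 1) xs → suc v ∈ xs
  suc∈ v∈ with ∈-map⁻ (_∸ 1) v∈
  ... | suc y , y∈ , refl = y∈
  ... | zero  , y∈ , refl with () ← All.lookup pos y∈

promoteRow-row : ∀ {M xs} → Row M xs → Row M (promoteRow M xs)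
promoteRow-row {xs = []}                    r                    = r
promoteRow-row {xs = 1 ∷ _}                 (row (s≤s () ∷ _) _)
promoteRow-row {xs = 2 ∷ _}                 (row (_ ∷ l) bnd)    =
  row (linked-∸1-++ bnd l) (All.++⁺ (bounded-∸1 (All.tail bnd)) (≤-refl ∷ []))
promoteRow-row {xs = suc (suc (suc _)) ∷ _} (row (_ ∷ l) bnd)    =
  row (linked-∸1 (s≤s (s≤s (s≤s z≤n)) ∷ l)) (bounded-∸1 bnd)

IsPreimageOn : ℕ → (ℕ → ℕ) → List ℕ → List ℕ → Set
IsPreimageOn M f xs ys = ∀ v → 2 ≤ v → v ≤ M → v ∈ ys ⇔ f v ∈ xs

preimage-∸1 : ∀ {M xs} → All (2 <_) xs → All (_≤ M) xs →
  IsPreimageOn M (rotate M) xs (List.map (_∸ 1) xs)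
preimage-∸1 {M} {xs} above2 bnd v 2≤v v≤M with rotate-cases v≤M
... | inj₁ (_ , rot≡) rewrite rot≡ = ∈-map-∸1 (All.map (<-trans z<s) above2)
... | inj₂ (refl , rot≡2) rewrite rot≡2 =
  mk⇔ (λ M∈ → ⊥-elim (<-irrefl refl (All.lookup bnd (to (∈-map-∸1 pos) M∈))))
      (λ 2∈ → ⊥-elim (<-irrefl refl (All.lookup above2 2∈)))
  where
  pos : All (1 ≤_) xs
  pos = All.map (<-trans z<s) above2

preimage-∸1-++ : ∀ {M xs} → All (2 <_) xs →
  IsPreimageOn M (rotate M) (2 ∷ xs) (List.map (_∸ 1) xs ++ [ M ])
preimage-∸1-++ {M} {xs} above2 v 2≤v v≤M with rotate-cases v≤M
... | inj₂ (refl , rot≡2) rewrite rot≡2 = mk⇔ (λ _ → here refl) (λ _ → ∈-++⁺ʳ _ (here refl))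
... | inj₁ (v<M , rot≡) rewrite rot≡ = mk⇔ suc∈ ∈promoted
  where
  pos : All (1 ≤_) xs
  pos = All.map (<-trans z<s) above2
  suc∈ : v ∈ List.map (_∸ 1) xs ++ [ M ] → suc v ∈ 2 ∷ xs
  suc∈ v∈ with ∈-++⁻ (List.map (_∸ 1) xs) v∈
  ... | inj₁ v∈xs       = there (to (∈-map-∸1 pos) v∈xs)
  ... | inj₂ (here v≡M) = ⊥-elim (<-irrefl v≡M v<M)
  ∈promoted : suc v ∈ 2 ∷ xs → v ∈ List.map (_∸ 1) xs ++ [ M ]
  ∈promoted (here v+1≡2) = ⊥-elim (<-irrefl (sym (suc-injective v+1≡2)) 2≤v)
  ∈promoted (there v+1∈) = ∈-++⁺ˡ (from (∈-map-∸1 pos) v+1∈)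

promoteRow-preimage : ∀ {M xs} → Row M xs → IsPreimageOn M (rotate M) xs (promoteRow M xs)
promoteRow-preimage {xs = []}                    _                    _ _ _ = mk⇔ (λ ()) (λ ())
promoteRow-preimage {xs = 1 ∷ _}                 (row (s≤s () ∷ _) _)
promoteRow-preimage {xs = 2 ∷ _}                 (row (_ ∷ l) _)      = preimage-∸1-++ (linked-head< l)
promoteRow-preimage {xs = suc (suc (suc _)) ∷ _} (row (_ ∷ l) bnd)    =
  preimage-∸1 (linked-head< (s≤s (s≤s (s≤s z≤n)) ∷ l)) bnd

promoteHookRows : ∀ {M xs ys} → HookRows M xs ys → HookRows M (promoteRow M xs) (promoteRow M ys)
promoteHookRows {M} {xs} {ys} (hookRows armRow legRow cov) =
  hookRows (promoteRow-row armRow) (promoteRow-row legRow) covers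
  where
  covers : ∀ v → 2 ≤ v → v ≤ M → v ∈ promoteRow M xs ⊎ v ∈ promoteRow M ys
  covers v 2≤v v≤M with rotate-range 2≤v v≤M
  ... | 2≤r , r≤M with cov _ 2≤r r≤M
  ...   | inj₁ r∈ = inj₁ (from (promoteRow-preimage armRow v 2≤v v≤M) r∈)
  ...   | inj₂ r∈ = inj₂ (from (promoteRow-preimage legRow v 2≤v v≤M) r∈)

-- Promotion acts rowwise

finalize-slideDot : ∀ {n} M (xs : Vec ℕ n) →
  toList (Vec.map (finalize M) (slideDot xs)) ≡ List.map (_∸ 1) (toList xs) ++ [ M ]
finalize-slideDot M []       = refl
finalize-slideDot M (x ∷ xs) = cong (x ∸ 1 ∷_) (finalize-slideDot M xs)

finalize-just : ∀ {n} M (xs : Vec ℕ n) →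
  toList (Vec.map (finalize M) (Vec.map just xs)) ≡ List.map (_∸ 1) (toList xs)
finalize-just M []       = refl
finalize-just M (x ∷ xs) = cong (x ∸ 1 ∷_) (finalize-just M xs)

promotion-rowwise : ∀ {a b} M x y (xs : Vec ℕ a) (ys : Vec ℕ b) →
  2 ≤ x → 2 ≤ y → x ≡ 2 ⊎ y ≡ 2 →
  let T = promotion M (hook 1 (x ∷ xs) (y ∷ ys)) in
  corner T ≡ 1 ×
  toList (arm T) ≡ promoteRow M (x ∷ toList xs) ×
  toList (leg T) ≡ promoteRow M (y ∷ toList ys)
promotion-rowwise M 2 2 xs ys _ _ _ =
  refl , finalize-slideDot M xs , finalize-slideDot M ys
promotion-rowwise M 2 y@(suc (suc (suc _))) xs ys _ _ _ =
  refl , finalize-slideDot M xs , finalize-just M (y ∷ ys)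
promotion-rowwise M x@(suc (suc (suc _))) 2 xs ys _ _ _ =
  refl , finalize-just M (x ∷ xs) , finalize-slideDot M ys
promotion-rowwise M (suc (suc (suc _))) (suc (suc (suc _))) xs ys _ _ (inj₁ ())
promotion-rowwise M (suc (suc (suc _))) (suc (suc (suc _))) xs ys _ _ (inj₂ ())
promotion-rowwise M 1 _ _ _ (s≤s ()) _ _
promotion-rowwise M 2 1 _ _ _ (s≤s ()) _
promotion-rowwise M (suc (suc (suc _))) 1 _ _ _ (s≤s ()) _

HookPreimage : ∀ {a b} → ℕ → (ℕ → ℕ) → HookFilling a b → HookFilling a b → Set
HookPreimage M f T T′ =
  IsPreimageOn M f (toList (arm T)) (toList (arm T′)) ×
  IsPreimageOn M f (toList (leg T)) (toList (leg T′))

promotion-step : ∀ {a b M} → 1 ≤ a → 1 ≤ b → 2 ≤ M → (T : HookFilling a b) → IsIncreasing M T →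
  IsIncreasing M (promotion M T) × HookPreimage M (rotate M) T (promotion M T)
promotion-step {M = M} (s≤s z≤n) (s≤s z≤n) 2≤M (hook c (x ∷ xs) (y ∷ ys)) inc
  with increasing⇒hookRows (hook c (x ∷ xs) (y ∷ ys)) (<⇒≤ 2≤M) inc
... | refl , rows@(hookRows armRow legRow _)
  with promotion-rowwise M x y xs ys (row-head≥2 armRow) (row-head≥2 legRow) (hookRows-head≡2 2≤M rows)
...   | corner≡1 , arm≡ , leg≡ =
  hookRows⇒increasing _ (<⇒≤ 2≤M) corner≡1
    (subst₂ (HookRows M) (sym arm≡) (sym leg≡) (promoteHookRows rows)) ,
  subst (IsPreimageOn M (rotate M) _) (sym arm≡) (promoteRow-preimage armRow) ,
  subst (IsPreimageOn M (rotate M) _) (sym leg≡) (promoteRow-preimage legRow)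

preimage-trans : ∀ {M f g h xs ys zs} → (∀ v → f (g v) ≡ h v) →
  (∀ {v} → 2 ≤ v → v ≤ M → 2 ≤ g v × g v ≤ M) →
  IsPreimageOn M f xs ys → IsPreimageOn M g ys zs → IsPreimageOn M h xs zs
preimage-trans {xs = xs} {zs = zs} fg≡h g-range f-pre g-pre v 2≤v v≤M =
  subst (λ w → v ∈ zs ⇔ w ∈ xs) (fg≡h v)
    (⇔.trans (g-pre v 2≤v v≤M) (f-pre _ (proj₁ (g-range 2≤v v≤M)) (proj₂ (g-range 2≤v v≤M))))

iterate-promotion : ∀ {a b M} → 1 ≤ a → 1 ≤ b → 2 ≤ M → (T : HookFilling a b) → IsIncreasing M T → ∀ j →
  IsIncreasing M (iter j (promotion M) T) × HookPreimage M (iter j (rotate M)) T (iter j (promotion M) T)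
iterate-promotion _ _ _ _ inc zero = inc , (λ _ _ _ → ⇔.refl) , (λ _ _ _ → ⇔.refl)
iterate-promotion {M = M} 1≤a 1≤b 2≤M T inc (suc j)
  with iterate-promotion 1≤a 1≤b 2≤M T inc j
... | incⱼ , armⱼ , legⱼ with promotion-step 1≤a 1≤b 2≤M _ incⱼ
...   | inc′ , arm′ , leg′ =
  inc′ ,
  preimage-trans (iter-suc (rotate M) j) rotate-range armⱼ arm′ ,
  preimage-trans (iter-suc (rotate M) j) rotate-range legⱼ leg′

preimage-fixed : ∀ {M f xs ys} → (∀ {v} → 2 ≤ v → v ≤ M → f v ≡ v) →
  Row M xs → Row M ys → IsPreimageOn M f xs ys → ys ≡ xs
preimage-fixed {f = f} {xs} {ys} fixes xsRow ysRow pre =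
  linked-<-unique (Linked.tail (Row.increasing ysRow)) (Linked.tail (Row.increasing xsRow)) ys⊆xs xs⊆ys
  where
  ys⊆xs : ∀ {v} → v ∈ ys → v ∈ xs
  ys⊆xs v∈ with row-range ysRow v∈
  ... | 2≤v , v≤M = subst (_∈ xs) (fixes 2≤v v≤M) (to (pre _ 2≤v v≤M) v∈)
  xs⊆ys : ∀ {v} → v ∈ xs → v ∈ ys
  xs⊆ys v∈ with row-range xsRow v∈
  ... | 2≤v , v≤M = from (pre _ 2≤v v≤M) (subst (_∈ xs) (sym (fixes 2≤v v≤M)) v∈)

hook-≡ : ∀ {a b} (T T′ : HookFilling a b) → corner T ≡ corner T′ →
  toList (arm T) ≡ toList (arm T′) → toList (leg T) ≡ toList (leg T′) → T ≡ T′
hook-≡ (hook c r l) (hook _ r′ l′) refl arm≡ leg≡ = cong₂ (hook c) (toList-inj arm≡) (toList-inj leg≡)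
  where
  toList-inj : ∀ {n} {xs ys : Vec ℕ n} → toList xs ≡ toList ys → xs ≡ ys
  toList-inj {xs = xs} {ys} eq = trans (sym (cast-is-id refl xs)) (toList-injective refl xs ys eq)

promotion-period : ∀ {a b} M → 1 ≤ a → 1 ≤ b → 2 ≤ M → (T : HookFilling a b) → IsIncreasing M T →
  iter (M ∸ 1) (promotion M) T ≡ T
promotion-period M 1≤a 1≤b 2≤M T inc with iterate-promotion 1≤a 1≤b 2≤M T inc (M ∸ 1)
... | inc′ , armPre , legPre
  with increasing⇒hookRows T (<⇒≤ 2≤M) inc
     | increasing⇒hookRows (iter (M ∸ 1) (promotion M) T) (<⇒≤ 2≤M) inc′
...   | corner≡1 , hookRows armRow legRow _ | corner′≡1 , hookRows armRow′ legRow′ _ =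
  hook-≡ _ _ (trans corner′≡1 (sym corner≡1))
    (preimage-fixed rotate-period armRow armRow′ armPre)
    (preimage-fixed rotate-period legRow legRow′ legPre)

-- A tableau of exact period M ∸ 1

interval : ℕ → (n : ℕ) → Vec ℕ n
interval s zero    = []
interval s (suc n) = s ∷ interval (suc s) n

∈-interval⁻ : ∀ {v} s n → v ∈ toList (interval s n) → s ≤ v × v < s + n
∈-interval⁻ s (suc n) (here refl) = ≤-refl , m<m+n s z<s
∈-interval⁻ {v} s (suc n) (there v∈) with ∈-interval⁻ (suc s) n v∈
... | s<v , v<s+n = <⇒≤ s<v , subst (v <_) (sym (+-suc s n)) v<s+n

∈-interval⁺ : ∀ {v} s n → s ≤ v → v < s + n → v ∈ toList (interval s n)
∈-interval⁺ s zero    s≤v v<s+0 = ⊥-elim (<⇒≱ (subst (_ <_) (+-identityʳ s) v<s+0) s≤v)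
∈-interval⁺ {v} s (suc n) s≤v v<s+n with m≤n⇒m<n∨m≡n s≤v
... | inj₂ refl = here refl
... | inj₁ s<v  = there (∈-interval⁺ (suc s) n s<v (subst (v <_) (+-suc s n) v<s+n))

linked-interval : ∀ {p s} n → p < s → Linked _<_ (p ∷ toList (interval s n))
linked-interval zero    p<s = [-]
linked-interval (suc n) p<s = p<s ∷ linked-interval n ≤-refl

linked-interval-++ : ∀ {p s t} k j → p < s → s + k ≤ t →
  Linked _<_ (p ∷ toList (interval s k Vec.++ interval t j))
linked-interval-++ {s = s} zero    j p<s s+0≤t =
  linked-interval j (<-≤-trans p<s (subst (_≤ _) (+-identityʳ s) s+0≤t))
linked-interval-++ {s = s} {t} (suc k) j p<s s+k≤t =
  p<s ∷ linked-interval-++ k j ≤-refl (subst (_≤ t) (+-suc s k) s+k≤t)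

staircase : (a k j : ℕ) → HookFilling a (k + j)
staircase a k j = hook 1 (interval 2 a) (interval 2 k Vec.++ interval (2 + a) j)

∈-staircase-leg : ∀ {v} a k j → v ∈ toList (leg (staircase a k j)) →
  (2 ≤ v × v < 2 + k) ⊎ (2 + a ≤ v × v < 2 + a + j)
∈-staircase-leg a k j v∈ rewrite toList-++ (interval 2 k) (interval (2 + a) j)
  with ∈-++⁻ (toList (interval 2 k)) v∈
... | inj₁ v∈₁ = inj₁ (∈-interval⁻ 2 k v∈₁)
... | inj₂ v∈₂ = inj₂ (∈-interval⁻ (2 + a) j v∈₂)

staircase-increasing : ∀ a k j → k ≤ a → IsIncreasing (suc (a + j)) (staircase a k j)
staircase-increasing a k j k≤a =
  hookRows⇒increasing (staircase a k j) (s≤s z≤n) refl (hookRows armRow legRow covers)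
  where
  armRow : Row (suc (a + j)) (toList (interval 2 a))
  armRow = row (linked-interval a ≤-refl)
    (All.tabulate λ v∈ → ≤-trans (≤-pred (proj₂ (∈-interval⁻ 2 a v∈))) (s≤s (m≤m+n a j)))
  legBounded : ∀ {v} → v ∈ toList (leg (staircase a k j)) → v ≤ suc (a + j)
  legBounded v∈ with ∈-staircase-leg a k j v∈
  ... | inj₁ (_ , v<k+2) = ≤-trans (≤-pred v<k+2) (s≤s (≤-trans k≤a (m≤m+n a j)))
  ... | inj₂ (_ , v<a+j+2) = ≤-pred v<a+j+2
  legRow : Row (suc (a + j)) (toList (leg (staircase a k j)))
  legRow = row (linked-interval-++ k j ≤-refl (s≤s (s≤s k≤a))) (All.tabulate legBounded)
  covers : ∀ v → 2 ≤ v → v ≤ suc (a + j) →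
    v ∈ toList (interval 2 a) ⊎ v ∈ toList (leg (staircase a k j))
  covers v 2≤v v≤M with v <? 2 + a
  ... | yes v<a+2 = inj₁ (∈-interval⁺ 2 a 2≤v v<a+2)
  ... | no  v≮a+2 = inj₂ (subst (_ ∈_) (sym (toList-++ (interval 2 k) (interval (2 + a) j)))
                          (∈-++⁺ʳ (toList (interval 2 k)) (∈-interval⁺ (2 + a) j (≮⇒≥ v≮a+2) (s≤s v≤M))))

invariant-interval-closed : ∀ {M f c xs} → 2 + c ≤ M → IsPreimageOn M f xs xs →
  (∀ {v} → 2 ≤ v → v < 2 + c → v ∈ xs) → (∀ {v} → v ∈ xs → v < 2 + c) →
  ∀ v → 2 ≤ v → v < 2 + c → f v < 2 + c
invariant-interval-closed c+2≤M invariant ⊆xs xs⊆ v 2≤v v<c+2 =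
  xs⊆ (to (invariant v 2≤v (<⇒≤ (<-≤-trans v<c+2 c+2≤M))) (⊆xs 2≤v v<c+2))

staircase-fixed-invariant : ∀ a k j m → 1 ≤ a → k ≤ a → 1 ≤ k + j →
  iter m (promotion (suc (a + j))) (staircase a k j) ≡ staircase a k j →
  HookPreimage (suc (a + j)) (iter m (rotate (suc (a + j)))) (staircase a k j) (staircase a k j)
staircase-fixed-invariant a k j m 1≤a k≤a 1≤k+j fixed =
  subst (HookPreimage (suc (a + j)) _ (staircase a k j)) fixed
    (proj₂ (iterate-promotion 1≤a 1≤k+j (s≤s (≤-trans 1≤a (m≤m+n a j))) (staircase a k j)
      (staircase-increasing a k j k≤a) m))

staircase-aperiodic : ∀ a k j m → 1 ≤ a → k ≤ a → 1 ≤ k + j → 1 ≤ j ⊎ k < a → 1 ≤ m → m < a + j →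
  iter m (promotion (suc (a + j))) (staircase a k j) ≢ staircase a k j
staircase-aperiodic a k (suc j) m 1≤a k≤a 1≤k+j _ 1≤m m<a+j fixed =
  rotate-moves-interval 1≤a a+2≤M 1≤m (s≤s m<a+j)
    (invariant-interval-closed a+2≤M
      (proj₁ (staircase-fixed-invariant a k (suc j) m 1≤a k≤a 1≤k+j fixed))
      (∈-interval⁺ 2 a) (proj₂ ∘ ∈-interval⁻ 2 a))
  where
  a+2≤M : 2 + a ≤ suc (a + suc j)
  a+2≤M = s≤s (m<m+n a z<s)
staircase-aperiodic a k zero m 1≤a k≤a 1≤k+0 (inj₂ k<a) 1≤m m<a+0 fixed =
  rotate-moves-interval (subst (1 ≤_) (+-identityʳ k) 1≤k+0) k+2≤M 1≤m (s≤s m<a+0)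
    (invariant-interval-closed k+2≤M
      (proj₂ (staircase-fixed-invariant a k zero m 1≤a k≤a 1≤k+0 fixed))
      ⊆leg leg⊆)
  where
  k+2≤M : 2 + k ≤ suc (a + 0)
  k+2≤M = s≤s (subst (k <_) (sym (+-identityʳ a)) k<a)
  ⊆leg : ∀ {v} → 2 ≤ v → v < 2 + k → v ∈ toList (leg (staircase a k zero))
  ⊆leg 2≤v v<k+2 = subst (_ ∈_) (sym (toList-++ (interval 2 k) (interval (2 + a) 0)))
    (∈-++⁺ˡ (∈-interval⁺ 2 k 2≤v v<k+2))
  leg⊆ : ∀ {v} → v ∈ toList (leg (staircase a k zero)) → v < 2 + k
  leg⊆ {v} v∈ with ∈-staircase-leg a k zero v∈
  ... | inj₁ (_ , v<k+2)         = v<k+2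
  ... | inj₂ (a+2≤v , v<a+0+2) =
    ⊥-elim (<⇒≱ v<a+0+2 (subst (_≤ v) (cong (2 +_) (sym (+-identityʳ a))) a+2≤v))
staircase-aperiodic a k zero m _ _ _ (inj₁ ())

armLength : ℕ → ℕ → ℕ
armLength N r = N ∸ r ∸ 1

suc-∸1 : ∀ {n} → 1 ≤ n → suc (n ∸ 1) ≡ n
suc-∸1 (s≤s _) = refl

≤-armLength : ∀ {N r} d → d + r + 1 ≤ N → d ≤ armLength N r
≤-armLength {N} {r} d d+r+1≤N = m+n≤o⇒m≤o∸n d (m+n≤o⇒m≤o∸n (d + 1) (subst (_≤ N) reorder d+r+1≤N))
  where
  reorder : d + r + 1 ≡ d + 1 + r
  reorder = trans (+-assoc d r 1) (trans (cong (d +_) (+-comm r 1)) (sym (+-assoc d 1 r)))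

N∸k≡1+armLength+j : ∀ {N k j} → k + j < N → N ∸ k ≡ suc (armLength N (k + j) + j)
N∸k≡1+armLength+j {N} {k} {j} k+j<N = begin
  N ∸ k                    ≡⟨ m∸n+n≡m j≤N∸k ⟨
  N ∸ k ∸ j + j            ≡⟨ cong (_+ j) (∸-+-assoc N k j) ⟩
  N ∸ (k + j) + j          ≡⟨ cong (_+ j) (suc-∸1 (m+n≤o⇒m≤o∸n 1 k+j<N)) ⟨
  suc (armLength N (k + j) + j) ∎
  where
  open ≡-Reasoning
  j≤N∸k : j ≤ N ∸ k
  j≤N∸k = m+n≤o⇒m≤o∸n j (subst (_≤ N) (+-comm k j) (<⇒≤ k+j<N))

theorem3p3 : (N r k : ℕ) → 1 ≤ r → r + 2 ≤ N → k ≤ r → k + r + 1 ≤ N →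
    (k < r ⊎ k + r + 2 ≤ N) →
    IsPromotionOrder N r k (N ∸ k ∸ 1)
theorem3p3 N r k 1≤r r+2≤N k≤r k+r+1≤N proper with m≤n⇒∃[o]m+o≡n k≤r
... | j , refl = ∸-monoˡ-≤ 1 2≤M , fixesAll , minimal
  where
  a : ℕ
  a = armLength N (k + j)
  1+r+1≤N : 1 + (k + j) + 1 ≤ N
  1+r+1≤N = subst (_≤ N) (+-suc (k + j) 1) r+2≤N
  1≤a : 1 ≤ a
  1≤a = ≤-armLength 1 1+r+1≤N
  k≤a : k ≤ a
  k≤a = ≤-armLength k k+r+1≤N
  M≡ : N ∸ k ≡ suc (a + j)
  M≡ = N∸k≡1+armLength+j {N} {k} {j} (≤-trans (s≤s (m≤m+n (k + j) 1)) 1+r+1≤N)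
  2≤M : 2 ≤ N ∸ k
  2≤M = subst (2 ≤_) (sym M≡) (s≤s (≤-trans 1≤a (m≤m+n a j)))
  proper′ : 1 ≤ j ⊎ k < a
  proper′ = Sum.map
    (λ k<k+j → +-cancelˡ-< k 0 j (subst (_< k + j) (sym (+-identityʳ k)) k<k+j))
    (λ k+r+2≤N → ≤-armLength (suc k) (subst (_≤ N) (+-suc (k + (k + j)) 1) k+r+2≤N))
    proper
  fixesAll : FixesAll N (k + j) k (N ∸ k ∸ 1)
  fixesAll T = promotion-period (N ∸ k) 1≤a 1≤r 2≤M T
  minimal : ∀ m → 1 ≤ m → m < N ∸ k ∸ 1 → ¬ FixesAll N (k + j) k m
  minimal m 1≤m m<order fixes =
    staircase-aperiodic a k j m 1≤a k≤a 1≤r proper′ 1≤m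
      (subst (λ M → m < M ∸ 1) M≡ m<order)
      (subst (λ M → iter m (promotion M) (staircase a k j) ≡ staircase a k j) M≡
        (fixes (staircase a k j)
          (subst (λ M → IsIncreasing M (staircase a k j)) (sym M≡) (staircase-increasing a k j k≤a))))
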